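{- Let $G$ be a finite simple graph without isolated vertices. Then $C_{tr}(G)\ge 2\,d_t(G)$.
   Context: A set $S\subseteq V(G)$ is a total dominating set if every vertex of $G$ is adjacent to some vertex of $S$ other than itself. The total domatic number $d_t(G)$ is the maximum number of sets in a partition of $V(G)$ into total dominating sets. A set $S\subseteq V$ is a total restrained dominating set (TRD-set) if every vertex of $V\setminus S$ is adjacent to at least one vertex of $S$ and to at least one other vertex of $V\setminus S$, and every vertex of $S$ is adjacent to at least one other vertex of $S$. Two disjoint sets $X,Y\subseteq V$ form a total restrained coalition if neither is a TRD-set but $X\cup Y$ is a TRD-set. A trc-partition of $G$ is a partition $\Phi$ of $V$ such that no member of $\Phi$ is a TRD-set and each member forms a total restrained coalition with some other member of $\Phi$. $C_{tr}(G)$ is the maximum cardinality of a trc-partition of $G$. -}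

module Defs where

open import Data.Nat using (ℕ; _≤_; _*_)
open import Data.Fin using (Fin)
open import Data.Bool using (Bool; true; false)
open import Data.Product using (Σ; ∃; ∃-syntax; _×_; _,_)
open import Data.Sum using (_⊎_)
open import Data.Empty using (⊥)
open import Relation.Nullary using (¬_)
open import Relation.Binary.PropositionalEquality using (_≡_; _≢_)

record Graph (n : ℕ) : Set where
  field
    adj    : Fin n → Fin n → Bool
    sym    : ∀ u v → adj u v ≡ adj v u
    irrefl : ∀ v → adj v v ≡ false

open Graph public

module _ {n : ℕ} (G : Graph n) where

  Adj : Fin n → Fin n → Set
  Adj u v = adj G u v ≡ true

  NoIsolated : Set
  NoIsolated = ∀ v → ∃[ u ] Adj v u

VSet : ℕ → Set₁
VSet n = Fin n → Set

_∪_ : ∀ {n} → VSet n → VSet n → VSet n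
(X ∪ Y) v = X v ⊎ Y v

Disjoint : ∀ {n} → VSet n → VSet n → Set
Disjoint {n} X Y = ∀ (v : Fin n) → X v → Y v → ⊥

module _ {n : ℕ} (G : Graph n) where

  -- every vertex is adjacent to some vertex of S (other than itself: automatic, adj irreflexive)
  TotalDominating : VSet n → Set
  TotalDominating S = ∀ v → ∃[ u ] (S u × Adj G v u)

  TRD : VSet n → Set
  TRD S = (∀ v → ¬ S v → (∃[ u ] (S u × Adj G v u)) × (∃[ u ] (¬ S u × Adj G v u)))
        × (∀ v → S v → ∃[ u ] (S u × Adj G v u))

  TRCoalition : VSet n → VSet n → Set
  TRCoalition X Y = Disjoint X Y × ¬ TRD X × ¬ TRD Y × TRD (X ∪ Y)

  -- a partition of V(G) into k (nonempty) members, given by a surjective class map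
  record Partition (k : ℕ) : Set where
    field
      cls  : Fin n → Fin k
      surj : ∀ (i : Fin k) → ∃[ v ] (cls v ≡ i)

    member : Fin k → VSet n
    member i v = cls v ≡ i

  open Partition public

  IsTotalDomaticPartition : ∀ {k} → Partition k → Set
  IsTotalDomaticPartition P = ∀ i → TotalDominating (member P i)

  IsTRCPartition : ∀ {k} → Partition k → Set
  IsTRCPartition P = (∀ i → ¬ TRD (member P i))
                   × (∀ i → ∃[ j ] (j ≢ i × TRCoalition (member P i) (member P j)))

  IsTotalDomaticNumber : ℕ → Set
  IsTotalDomaticNumber d =
    (Σ (Partition d) IsTotalDomaticPartition)
    × (∀ k → Σ (Partition k) IsTotalDomaticPartition → k ≤ d)

  IsTRCNumber : ℕ → Set
  IsTRCNumber c =
    (Σ (Partition c) IsTRCPartition)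
    × (∀ k → Σ (Partition k) IsTRCPartition → k ≤ c)

-- Let V₀, …, V_{d−1} be a total domatic partition with d ≥ 2. Shrink each Vᵢ to a minimal total
-- dominating set Mᵢ, pick xᵢ ∈ Mᵢ, put Bᵢ = Mᵢ ∖ {xᵢ} and let R be the vertices in no Mᵢ.
-- R is not total dominating, since otherwise R, M₀, …, M_{d−1} would be d + 1 total dominating
-- classes; {xᵢ} is not, by irreflexivity; Bᵢ is not, by minimality of Mᵢ. Each Mᵢ = {xᵢ} ∪ Bᵢ
-- is a TRD-set because its complement contains another Mⱼ, so {xᵢ} and Bᵢ are coalition
-- partners. If R ∪ {x₀} is total dominating it is a TRD-set for the same reason and R becomes a
-- (2d+1)-st class; otherwise R is merged into {x₀}, giving 2d classes. For d = 1 the partition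
-- {v}, V ∖ {v} works. Finally C_tr(G) exists because TRC-partitions of a given size can be
-- found by exhaustive search and have at most |V| classes.

module Submission where

open import Defs hiding (sym)
open import Data.Bool using (Bool; true; false; T)
import Data.Bool as Bool
open import Data.Fin using (Fin; zero; suc; _≟_)
open import Data.Fin.Properties using (any?; all?; injective⇒≤; +↔⊎)
open import Data.List using (List; []; _∷_; allFin)
open import Data.List.Membership.Propositional using (_∈_)
open import Data.List.Membership.Propositional.Properties using (∈-allFin)
open import Data.List.Relation.Unary.Any using (here; there)
open import Data.Nat using (ℕ; zero; suc; _+_; _*_; _≤_; z≤n)
open import Data.Nat.Properties
  using (≤-refl; ≤-reflexive; ≤-trans; ≤-pred; ≤∧≢⇒<; 1+n≰n; +-monoʳ-≤; +-identityʳ)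
open import Data.Product using (Σ; ∃; ∃-syntax; _×_; _,_; proj₁; proj₂)
open import Data.Sum using (_⊎_; inj₁; inj₂; swap) renaming (map to map-⊎)
open import Data.Vec.Functional using (head; tail) renaming (_∷_ to _∷ᶠ_)
open import Data.Vec.Functional.Properties using (∷-cong)
open import Function using (_∘_)
open import Function.Bundles using (_↔_; Inverse)
open import Function.Properties.Inverse using (↔-refl; ↔-trans)
open import Data.Sum.Function.Propositional using (_⊎-↔_)
open import Relation.Binary.PropositionalEquality using (_≡_; _≢_; _≗_; refl; sym; trans; cong; subst)
open import Relation.Nullary using (¬_; Dec; yes; no; contradiction)
open import Relation.Nullary.Decidable
  using (_×-dec_; _→-dec_; ¬?; map′; ⌊_⌋; toWitness; fromWitness; T?; toSum)
open import Relation.Unary using (Decidable; _⊆_; _⊆′_; _≐_)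
open import Relation.Unary.Properties using (_∪?_; ≐-sym)

∃-fun? : ∀ {m k} (Φ : (Fin m → Fin k) → Set) → (∀ {f g} → f ≗ g → Φ f → Φ g) →
         (∀ f → Dec (Φ f)) → Dec (∃ Φ)
∃-fun? {zero} Φ resp Φ? = map′ (λ φ → _ , φ) (λ (f , φ) → resp (λ ()) φ) (Φ? λ ())
∃-fun? {suc m} Φ resp Φ? =
  map′ (λ (a , f , φ) → a ∷ᶠ f , φ) (λ (f , φ) → head f , tail f , resp (∷-cong refl λ _ → refl) φ)
       (any? λ a → ∃-fun? (Φ ∘ (a ∷ᶠ_)) (λ f≗g → resp (∷-cong refl f≗g)) (Φ? ∘ (a ∷ᶠ_)))

greatest : (R : ℕ → Set) → Decidable R → ∀ m {k} → R k → k ≤ m →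
           ∃[ c ] (R c × (∀ {k} → R k → k ≤ m → k ≤ c))
greatest R R? m r k≤m with R? m
... | yes Rm = m , Rm , λ _ k≤m → k≤m
greatest R R? zero r z≤n | no ¬R0 = contradiction r ¬R0
greatest R R? (suc m) r k≤1+m | no ¬R[1+m] =
  let (c , Rc , max) = greatest R R? m r (below r k≤1+m)
  in c , Rc , λ Rk k≤1+m → max Rk (below Rk k≤1+m)
  where
  below : ∀ {k} → R k → k ≤ suc m → k ≤ m
  below Rk k≤1+m = ≤-pred (≤∧≢⇒< k≤1+m λ { refl → ¬R[1+m] Rk })

∪-cong-≐ : ∀ {n} {X X′ Y Y′ : VSet n} → X ≐ X′ → Y ≐ Y′ → (X ∪ Y) ≐ (X′ ∪ Y′)
∪-cong-≐ (X⊆X′ , X′⊆X) (Y⊆Y′ , Y′⊆Y) = map-⊎ X⊆X′ Y⊆Y′ , map-⊎ X′⊆X Y′⊆Y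

module _ {n : ℕ} (G : Graph n) where

  ¬Adj-refl : ∀ {v} → ¬ Adj G v v
  ¬Adj-refl {v} a = contradiction (trans (sym a) (irrefl G v)) λ ()

  Adj? : ∀ u v → Dec (Adj G u v)
  Adj? u v = adj G u v Bool.≟ true

  TotalDominating? : ∀ {X : VSet n} → Decidable X → Dec (TotalDominating G X)
  TotalDominating? X? = all? λ v → any? λ u → X? u ×-dec Adj? v u

  TRD? : ∀ {X : VSet n} → Decidable X → Dec (TRD G X)
  TRD? X? = all? (λ v → ¬? (X? v) →-dec (any? (λ u → X? u ×-dec Adj? v u)
                                          ×-dec any? (λ u → ¬? (X? u) ×-dec Adj? v u)))
            ×-dec all? (λ v → X? v →-dec any? λ u → X? u ×-dec Adj? v u)

  TotalDominating-mono : ∀ {X Y : VSet n} → X ⊆ Y → TotalDominating G X → TotalDominating G Y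
  TotalDominating-mono X⊆Y tdX v = let (u , Xu , a) = tdX v in u , X⊆Y Xu , a

  TRD⇒TotalDominating : ∀ {X : VSet n} → Decidable X → TRD G X → TotalDominating G X
  TRD⇒TotalDominating X? (outside , inside) v with X? v
  ... | yes Xv = inside v Xv
  ... | no ¬Xv = proj₁ (outside v ¬Xv)

  ¬TotalDominating⇒¬TRD : ∀ {X : VSet n} → Decidable X → ¬ TotalDominating G X → ¬ TRD G X
  ¬TotalDominating⇒¬TRD X? ¬td = ¬td ∘ TRD⇒TotalDominating X?

  TRD-resp-≐ : ∀ {X Y : VSet n} → X ≐ Y → TRD G X → TRD G Y
  TRD-resp-≐ (X⊆Y , Y⊆X) (outside , inside) =
    (λ v ¬Yv → let ((u , Xu , a) , (w , ¬Xw , b)) = outside v (¬Yv ∘ X⊆Y)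
               in (u , X⊆Y Xu , a) , (w , ¬Xw ∘ Y⊆X , b))
    , λ v Yv → let (u , Xu , a) = inside v (Y⊆X Yv) in u , X⊆Y Xu , a

  TRD-∪-comm : ∀ {X Y : VSet n} → TRD G (X ∪ Y) → TRD G (Y ∪ X)
  TRD-∪-comm = TRD-resp-≐ (swap , swap)

  disjoint-TotalDominating⇒TRD : ∀ {X Y : VSet n} → TotalDominating G X → TotalDominating G Y →
                                  Disjoint X Y → TRD G X
  disjoint-TotalDominating⇒TRD tdX tdY X∩Y=∅ =
    (λ v _ → tdX v , let (u , Yu , a) = tdY v in u , (λ Xu → X∩Y=∅ u Xu Yu) , a) , λ v _ → tdX v

  ¬TotalDominating-singleton : ∀ {v} → ¬ TotalDominating G (_≡ v)
  ¬TotalDominating-singleton {v} td with td v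
  ... | .v , refl , a = ¬Adj-refl a

  ¬TRD-singleton-complement : ∀ {v} → ¬ TRD G (_≢ v)
  ¬TRD-singleton-complement {v} (outside , _) with outside v (λ v≢v → v≢v refl)
  ... | _ , (u , ¬u≢v , a) with u ≟ v
  ...   | yes refl = ¬Adj-refl a
  ...   | no u≢v   = ¬u≢v u≢v

  Partition-≤ : ∀ {k} → Partition G k → k ≤ n
  Partition-≤ P = injective⇒≤ {f = proj₁ ∘ surj P} λ {i} {j} vᵢ≡vⱼ →
    trans (sym (proj₂ (surj P i))) (trans (cong (cls P) vᵢ≡vⱼ) (proj₂ (surj P j)))

  member? : ∀ {k} (P : Partition G k) i → Decidable (member P i)
  member? P i v = cls P v ≟ i

  IsTRCPartition? : ∀ {k} (P : Partition G k) → Dec (IsTRCPartition G P)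
  IsTRCPartition? P =
    all? (λ i → ¬? (TRD? (member? P i)))
    ×-dec all? λ i → any? λ j → ¬? (j ≟ i)
      ×-dec all? (λ v → member? P i v →-dec (member? P j v →-dec no λ ()))
      ×-dec ¬? (TRD? (member? P i)) ×-dec ¬? (TRD? (member? P j))
      ×-dec TRD? (member? P i ∪? member? P j)

  IsTRCPartition-resp : ∀ {k} (P Q : Partition G k) → cls P ≗ cls Q →
                        IsTRCPartition G P → IsTRCPartition G Q
  IsTRCPartition-resp P Q P≗Q (¬trd , coalition) =
    (λ i → ¬trd i ∘ TRD-resp-≐ (≐-sym (same i)))
    , λ i → let (j , j≢i , disjoint , ¬trdᵢ , ¬trdⱼ , trd) = coalition i
            in j , j≢i , (λ v Qᵢv Qⱼv → disjoint v (proj₂ (same i) Qᵢv) (proj₂ (same j) Qⱼv))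
               , ¬trdᵢ ∘ TRD-resp-≐ (≐-sym (same i)) , ¬trdⱼ ∘ TRD-resp-≐ (≐-sym (same j))
               , TRD-resp-≐ (∪-cong-≐ (same i) (same j)) trd
    where
    same : ∀ i → member P i ≐ member Q i
    same i = (λ {v} → trans (sym (P≗Q v))) , λ {v} → trans (P≗Q v)

  ∃-Partition? : ∀ {k} (Φ : Partition G k → Set) → (∀ P Q → cls P ≗ cls Q → Φ P → Φ Q) →
                 (∀ P → Dec (Φ P)) → Dec (Σ (Partition G k) Φ)
  ∃-Partition? {k} Φ resp Φ? =
    map′ (λ (f , s , φ) → record { cls = f ; surj = s } , φ) (λ (P , φ) → cls P , surj P , φ)
         (∃-fun? Ψ resp′ Ψ?)
    where
    Ψ : (Fin n → Fin k) → Set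
    Ψ f = Σ (∀ i → ∃[ v ] f v ≡ i) λ s → Φ (record { cls = f ; surj = s })
    resp′ : ∀ {f g} → f ≗ g → Ψ f → Ψ g
    resp′ f≗g (s , φ) = (λ i → let (v , fv≡i) = s i in v , trans (sym (f≗g v)) fv≡i) , resp _ _ f≗g φ
    Ψ? : ∀ f → Dec (Ψ f)
    Ψ? f with all? (λ i → any? (λ v → f v ≟ i))
    ... | no ¬s = no (¬s ∘ proj₁)
    ... | yes s = map′ (s ,_) (λ (_ , φ) → resp _ _ (λ _ → refl) φ) (Φ? _)

  TRCPartition? : ∀ k → Dec (Σ (Partition G k) (IsTRCPartition G))
  TRCPartition? k = ∃-Partition? (IsTRCPartition G) IsTRCPartition-resp IsTRCPartition?

  trcNumber : ∀ {k m} → Σ (Partition G k) (IsTRCPartition G) → m ≤ k → ∃[ c ] (IsTRCNumber G c × m ≤ c)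
  trcNumber q m≤k
    with greatest (λ c → Σ (Partition G c) (IsTRCPartition G)) TRCPartition? n q (Partition-≤ (proj₁ q))
  ... | c , qc , max = c , (qc , λ _ q′ → max q′ (Partition-≤ (proj₁ q′)))
                         , ≤-trans m≤k (max q (Partition-≤ (proj₁ q)))

  module Labelling {I : Set} {k : ℕ} (ι : Fin k ↔ I) (label : Fin n → I) (Atom : I → VSet n)
                   (label-≐ : ∀ p → (λ v → label v ≡ p) ≐ Atom p)
                   (Atom-nonempty : ∀ p → ∃ (Atom p)) where

    open Inverse ι

    labelled : Partition G k
    labelled = record
      { cls  = from ∘ label
      ; surj = λ j → let (v , a) = Atom-nonempty (to j) in v , inverseʳ (proj₂ (label-≐ (to j)) a)
      }

    member-≐ : ∀ {j p} → to j ≡ p → member labelled j ≐ Atom p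
    member-≐ tj≡p = (λ e → proj₁ (label-≐ _) (trans (sym (inverseˡ (sym e))) tj≡p))
                  , (λ a → inverseʳ (trans (proj₂ (label-≐ _) a) (sym tj≡p)))

    atom-¬TotalDominating⇒¬TRD : ∀ p → ¬ TotalDominating G (Atom p) → ¬ TRD G (Atom p)
    atom-¬TotalDominating⇒¬TRD p ¬td =
      ¬TotalDominating⇒¬TRD (member? labelled (from p))
        (¬td ∘ TotalDominating-mono (proj₁ class≐))
      ∘ TRD-resp-≐ (≐-sym class≐)
      where
      class≐ : member labelled (from p) ≐ Atom p
      class≐ = member-≐ (strictlyInverseˡ p)

    domaticPartition : (∀ p → TotalDominating G (Atom p)) → Σ (Partition G k) (IsTotalDomaticPartition G)
    domaticPartition td = labelled , λ j → TotalDominating-mono (proj₂ (member-≐ refl)) (td (to j))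

    trcPartition : (∀ p → ¬ TRD G (Atom p)) → (∀ p → ∃[ q ] (q ≢ p × TRD G (Atom p ∪ Atom q))) →
                   Σ (Partition G k) (IsTRCPartition G)
    trcPartition ¬trd coalition = labelled , ¬trdᵐ , λ j →
      let (q , q≢p , trd) = coalition (to j)
          fromq≢j = from-≢ q≢p
      in from q , fromq≢j , (λ v ∈j ∈q → fromq≢j (trans (sym ∈q) ∈j)) , ¬trdᵐ j , ¬trdᵐ (from q)
         , TRD-resp-≐ (≐-sym (∪-cong-≐ (member-≐ refl) (member-≐ (strictlyInverseˡ q)))) trd
      where
      ¬trdᵐ : ∀ j → ¬ TRD G (member labelled j)
      ¬trdᵐ j = ¬trd (to j) ∘ TRD-resp-≐ (member-≐ refl)

      from-≢ : ∀ {q j} → q ≢ to j → from q ≢ j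
      from-≢ {q} q≢p fq≡j = q≢p (trans (sym (strictlyInverseˡ q)) (cong to fq≡j))

module _ {n : ℕ} where

  ⟦_⟧ : (Fin n → Bool) → VSet n
  ⟦ S ⟧ v = T (S v)

  remove : Fin n → (Fin n → Bool) → Fin n → Bool
  remove y S v with v ≟ y
  ... | yes _ = false
  ... | no  _ = S v

  remove-≐ : ∀ y S → ⟦ remove y S ⟧ ≐ (λ v → T (S v) × v ≢ y)
  remove-≐ y S = sound , complete
    where
    sound : ⟦ remove y S ⟧ ⊆ (λ v → T (S v) × v ≢ y)
    sound {v} ∈S-y with v ≟ y
    ... | no v≢y = ∈S-y , v≢y
    complete : (λ v → T (S v) × v ≢ y) ⊆ ⟦ remove y S ⟧
    complete {v} (∈S , v≢y) with v ≟ y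
    ... | yes v≡y = v≢y v≡y
    ... | no  _   = ∈S

  remove-mono : ∀ y {S S′} → ⟦ S ⟧ ⊆′ ⟦ S′ ⟧ → ⟦ remove y S ⟧ ⊆′ ⟦ remove y S′ ⟧
  remove-mono y {S} {S′} S⊆S′ v ∈S-y =
    let (∈S , v≢y) = proj₁ (remove-≐ y S) ∈S-y in proj₂ (remove-≐ y S′) (S⊆S′ v ∈S , v≢y)

  module Minimal (Φ : (Fin n → Bool) → Set) (Φ? : ∀ S → Dec (Φ S))
                 (Φ-mono : ∀ {S S′} → ⟦ S ⟧ ⊆′ ⟦ S′ ⟧ → Φ S → Φ S′) where

    prune : List (Fin n) → (Fin n → Bool) → Fin n → Bool
    prune []       S = S
    prune (y ∷ ys) S with Φ? (remove y S)
    ... | yes _ = prune ys (remove y S)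
    ... | no  _ = prune ys S

    prune-⊆ : ∀ ys S → ⟦ prune ys S ⟧ ⊆′ ⟦ S ⟧
    prune-⊆ []       S v ∈M = ∈M
    prune-⊆ (y ∷ ys) S v ∈M with Φ? (remove y S)
    ... | yes _ = proj₁ (proj₁ (remove-≐ y S) (prune-⊆ ys (remove y S) v ∈M))
    ... | no  _ = prune-⊆ ys S v ∈M

    prune-Φ : ∀ ys S → Φ S → Φ (prune ys S)
    prune-Φ []       S φ = φ
    prune-Φ (y ∷ ys) S φ with Φ? (remove y S)
    ... | yes φ′ = prune-Φ ys (remove y S) φ′
    ... | no  _  = prune-Φ ys S φ

    -- A vertex kept when visited stays indispensable: later steps only shrink the set.
    prune-minimal : ∀ ys S {y} → y ∈ ys → T (prune ys S y) → ¬ Φ (remove y (prune ys S))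
    prune-minimal (y ∷ ys) S (here refl) ∈M with Φ? (remove y S)
    ... | yes _  = contradiction refl (proj₂ (proj₁ (remove-≐ y S) (prune-⊆ ys (remove y S) y ∈M)))
    ... | no ¬φ  = ¬φ ∘ Φ-mono (remove-mono y (prune-⊆ ys S))
    prune-minimal (z ∷ ys) S (there y∈ys) ∈M with Φ? (remove z S)
    ... | yes _ = prune-minimal ys (remove z S) y∈ys ∈M
    ... | no  _ = prune-minimal ys S y∈ys ∈M

    minimal-⊆ : ∀ S → Φ S → ∃[ M ] (⟦ M ⟧ ⊆′ ⟦ S ⟧ × Φ M × ∀ {y} → T (M y) → ¬ Φ (remove y M))
    minimal-⊆ S φ = prune (allFin n) S , prune-⊆ (allFin n) S , prune-Φ (allFin n) S φ
                  , prune-minimal (allFin n) S (∈-allFin _)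

module FromTotalDomaticPartition {n : ℕ} (G : Graph n) {d′ : ℕ} (P : Partition G (2 + d′))
                    (tdP : IsTotalDomaticPartition G P) where

  d : ℕ
  d = 2 + d′

  open Minimal (TotalDominating G ∘ ⟦_⟧) (λ S → TotalDominating? G (T? ∘ S))
               (λ S⊆S′ → TotalDominating-mono G (S⊆S′ _))

  inClass : Fin d → Fin n → Bool
  inClass i v = ⌊ cls P v ≟ i ⌋

  minimalClass : ∀ i → ∃[ M ] (⟦ M ⟧ ⊆′ ⟦ inClass i ⟧ × TotalDominating G ⟦ M ⟧ ×
                               ∀ {y} → T (M y) → ¬ TotalDominating G ⟦ remove y M ⟧)
  minimalClass i = minimal-⊆ (inClass i) (TotalDominating-mono G fromWitness (tdP i))

  M : Fin d → Fin n → Bool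
  M i = proj₁ (minimalClass i)

  M-⊆ : ∀ {i v} → T (M i v) → cls P v ≡ i
  M-⊆ {i} {v} m = toWitness (proj₁ (proj₂ (minimalClass i)) v m)

  M-td : ∀ i → TotalDominating G ⟦ M i ⟧
  M-td i = proj₁ (proj₂ (proj₂ (minimalClass i)))

  M-minimal : ∀ i {y} → T (M i y) → ¬ TotalDominating G ⟦ remove y (M i) ⟧
  M-minimal i = proj₂ (proj₂ (proj₂ (minimalClass i)))

  M-nonempty : ∀ i → ∃ ⟦ M i ⟧
  M-nonempty i = let (u , m , _) = M-td i (proj₁ (surj P i)) in u , m

  x : Fin d → Fin n
  x i = proj₁ (M-nonempty i)

  x∈M : ∀ i → T (M i (x i))
  x∈M i = proj₂ (M-nonempty i)

  cls-x : ∀ i → cls P (x i) ≡ i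
  cls-x i = M-⊆ (x∈M i)

  -- Since Mᵢ ⊆ Vᵢ, a vertex v lies in some Mᵢ iff it lies in M (cls P v).
  Rest : VSet n
  Rest v = ¬ T (M (cls P v) v)

  Rest-∩-M : ∀ {i v} → Rest v → ¬ T (M i v)
  Rest-∩-M {v = v} r m = r (subst (λ i → T (M i v)) (sym (M-⊆ m)) m)

  B : Fin d → VSet n
  B i v = T (M i v) × v ≢ x i

  B-nonempty : ∀ i → ∃ (B i)
  B-nonempty i = let (u , m , a) = M-td i (x i)
                 in u , m , λ u≡x → ¬Adj-refl G (subst (Adj G (x i)) u≡x a)

  B-¬TotalDominating : ∀ i → ¬ TotalDominating G (B i)
  B-¬TotalDominating i = M-minimal i (x∈M i) ∘ TotalDominating-mono G (proj₂ (remove-≐ (x i) (M i)))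

  Rest-¬TotalDominating : (∀ k → Σ (Partition G k) (IsTotalDomaticPartition G) → k ≤ d) →
                          ¬ TotalDominating G Rest
  Rest-¬TotalDominating maxd tdRest =
    1+n≰n (maxd (1 + d) (domaticPartition λ { (inj₁ _) → tdRest ; (inj₂ i) → M-td i }))
    where
    label : Fin n → Fin 1 ⊎ Fin d
    label v with T? (M (cls P v) v)
    ... | yes _ = inj₂ (cls P v)
    ... | no  _ = inj₁ zero

    Atom : Fin 1 ⊎ Fin d → VSet n
    Atom (inj₁ _) = Rest
    Atom (inj₂ i) = ⟦ M i ⟧

    label-sound : ∀ {p v} → label v ≡ p → Atom p v
    label-sound {v = v} e with T? (M (cls P v) v)
    label-sound refl | yes m  = m
    label-sound refl | no  ¬m = ¬m

    label-complete : ∀ {p v} → Atom p v → label v ≡ p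
    label-complete {inj₁ zero} {v} r with T? (M (cls P v) v)
    ... | yes m = contradiction m r
    ... | no  _ = refl
    label-complete {inj₂ i} {v} m with M-⊆ m
    ... | refl with T? (M (cls P v) v)
    ...   | yes _  = refl
    ...   | no  ¬m = contradiction m ¬m

    nonempty : ∀ p → ∃ (Atom p)
    nonempty (inj₁ _) = let (u , r , _) = tdRest (x zero) in u , r
    nonempty (inj₂ i) = M-nonempty i

    open Labelling G +↔⊎ label Atom (λ _ → label-sound , label-complete) nonempty

  Rest? : Decidable Rest
  Rest? v = ¬? (T? (M (cls P v) v))

  other : Fin d → Fin d
  other zero    = suc zero
  other (suc _) = zero

  other-≢ : ∀ i → other i ≢ i
  other-≢ zero    ()
  other-≢ (suc _) ()

  ClassOrRest : Fin d → VSet n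
  ClassOrRest i v = cls P v ≡ i ⊎ Rest v

  TRD-within : ∀ i {U} → TotalDominating G U → U ⊆ ClassOrRest i → TRD G U
  TRD-within i tdU U⊆ = disjoint-TotalDominating⇒TRD G tdU (M-td (other i)) λ v u m → disjoint (U⊆ u) m
    where
    disjoint : ∀ {v} → ClassOrRest i v → ¬ T (M (other i) v)
    disjoint (inj₁ c) m = other-≢ i (trans (sym (M-⊆ m)) c)
    disjoint (inj₂ r) m = Rest-∩-M r m

  pair-TRD : ∀ i {A : VSet n} → A (x i) → A ⊆ ClassOrRest i → TRD G (A ∪ B i)
  pair-TRD i {A} x∈A A⊆ = TRD-within i (TotalDominating-mono G split (M-td i)) λ
    { (inj₁ a)       → A⊆ a
    ; (inj₂ (m , _)) → inj₁ (M-⊆ m)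
    }
    where
    split : ⟦ M i ⟧ ⊆ A ∪ B i
    split {v} m with v ≟ x i
    ... | yes refl = inj₁ x∈A
    ... | no  v≢x  = inj₂ (m , v≢x)

  Piece : Fin d ⊎ (Fin d ⊎ Fin 1) → VSet n
  Piece (inj₁ i)        = _≡ x i
  Piece (inj₂ (inj₁ i)) = B i
  Piece (inj₂ (inj₂ _)) = Rest

  piece : Fin n → Fin d ⊎ (Fin d ⊎ Fin 1)
  piece v with T? (M (cls P v) v) | v ≟ x (cls P v)
  ... | no  _ | _     = inj₂ (inj₂ zero)
  ... | yes _ | yes _ = inj₁ (cls P v)
  ... | yes _ | no  _ = inj₂ (inj₁ (cls P v))

  piece-sound : ∀ {p v} → piece v ≡ p → Piece p v
  piece-sound {v = v} e with T? (M (cls P v) v) | v ≟ x (cls P v)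
  piece-sound refl | no  ¬m | _       = ¬m
  piece-sound refl | yes _  | yes v≡x = v≡x
  piece-sound refl | yes m  | no  v≢x = m , v≢x

  piece-complete : ∀ {p v} → Piece p v → piece v ≡ p
  piece-complete {inj₁ i} refl with T? (M (cls P (x i)) (x i)) | x i ≟ x (cls P (x i))
  ... | no ¬m | _       = contradiction (subst (λ j → T (M j (x i))) (sym (cls-x i)) (x∈M i)) ¬m
  ... | yes _ | yes _   = cong inj₁ (cls-x i)
  ... | yes _ | no  x≢x = contradiction (cong x (sym (cls-x i))) x≢x
  piece-complete {inj₂ (inj₁ i)} {v} (m , v≢x) with M-⊆ m
  ... | refl with T? (M (cls P v) v) | v ≟ x (cls P v)
  ...   | no ¬m | _       = contradiction m ¬m
  ...   | yes _ | yes v≡x = contradiction v≡x v≢x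
  ...   | yes _ | no  _   = refl
  piece-complete {inj₂ (inj₂ zero)} {v} r with T? (M (cls P v) v) | v ≟ x (cls P v)
  ... | yes m | _ = contradiction m r
  ... | no  _ | _ = refl

  restApartPartition : TotalDominating G (Rest ∪ (_≡ x zero)) → ¬ TotalDominating G Rest →
                       Σ (Partition G (d + (d + 1))) (IsTRCPartition G)
  restApartPartition td ¬tdRest = trcPartition (λ p → atom-¬TotalDominating⇒¬TRD p (¬td p)) coalition
    where
    nonempty : ∀ p → ∃ (Piece p)
    nonempty (inj₁ i)        = x i , refl
    nonempty (inj₂ (inj₁ i)) = B-nonempty i
    nonempty (inj₂ (inj₂ _)) with td (x zero)
    ... | u , inj₁ r    , _ = u , r
    ... | u , inj₂ refl , a = contradiction a (¬Adj-refl G)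

    open Labelling G (↔-trans +↔⊎ (↔-refl ⊎-↔ +↔⊎)) piece Piece
                   (λ _ → piece-sound , piece-complete) nonempty

    ¬td : ∀ p → ¬ TotalDominating G (Piece p)
    ¬td (inj₁ i)        = ¬TotalDominating-singleton G
    ¬td (inj₂ (inj₁ i)) = B-¬TotalDominating i
    ¬td (inj₂ (inj₂ _)) = ¬tdRest

    x-pair : ∀ i → TRD G (Piece (inj₁ i) ∪ B i)
    x-pair i = pair-TRD i refl λ { refl → inj₁ (cls-x i) }

    coalition : ∀ p → ∃[ q ] (q ≢ p × TRD G (Piece p ∪ Piece q))
    coalition (inj₁ i)        = inj₂ (inj₁ i) , (λ ()) , x-pair i
    coalition (inj₂ (inj₁ i)) = inj₁ i , (λ ()) , TRD-∪-comm G (x-pair i)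
    coalition (inj₂ (inj₂ _)) = inj₁ zero , (λ ()) , TRD-within zero td λ
      { (inj₁ r)    → inj₂ r
      ; (inj₂ refl) → inj₁ (cls-x zero)
      }

  merge : Fin d ⊎ (Fin d ⊎ Fin 1) → Fin d ⊎ Fin d
  merge (inj₁ i)        = inj₁ i
  merge (inj₂ (inj₁ i)) = inj₂ i
  merge (inj₂ (inj₂ _)) = inj₁ zero

  MergedPiece : Fin d ⊎ Fin d → VSet n
  MergedPiece (inj₁ zero)    = Rest ∪ (_≡ x zero)
  MergedPiece (inj₁ (suc i)) = _≡ x (suc i)
  MergedPiece (inj₂ i)       = B i

  merge-sound : ∀ {p q v} → Piece p v → merge p ≡ q → MergedPiece q v
  merge-sound {inj₁ zero}      v≡x refl = inj₂ v≡x
  merge-sound {inj₁ (suc i)}   v≡x refl = v≡x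
  merge-sound {inj₂ (inj₁ i)}  b   refl = b
  merge-sound {inj₂ (inj₂ _)}  r   refl = inj₁ r

  merge-complete : ∀ {q v} → MergedPiece q v → merge (piece v) ≡ q
  merge-complete {inj₁ zero}    (inj₁ r)   = cong merge (piece-complete {inj₂ (inj₂ zero)} r)
  merge-complete {inj₁ zero}    (inj₂ v≡x) = cong merge (piece-complete {inj₁ zero} v≡x)
  merge-complete {inj₁ (suc i)} v≡x        = cong merge (piece-complete {inj₁ (suc i)} v≡x)
  merge-complete {inj₂ i}       b          = cong merge (piece-complete {inj₂ (inj₁ i)} b)

  x∈MergedPiece : ∀ i → MergedPiece (inj₁ i) (x i)
  x∈MergedPiece zero    = inj₂ refl
  x∈MergedPiece (suc i) = refl

  MergedPiece-⊆ : ∀ i → MergedPiece (inj₁ i) ⊆ ClassOrRest i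
  MergedPiece-⊆ zero    (inj₁ r)    = inj₂ r
  MergedPiece-⊆ zero    (inj₂ refl) = inj₁ (cls-x zero)
  MergedPiece-⊆ (suc i) refl        = inj₁ (cls-x (suc i))

  restMergedPartition : ¬ TotalDominating G (Rest ∪ (_≡ x zero)) →
                        Σ (Partition G (d + d)) (IsTRCPartition G)
  restMergedPartition ¬tdRest∪x₀ = trcPartition (λ q → atom-¬TotalDominating⇒¬TRD q (¬td q)) coalition
    where
    nonempty : ∀ q → ∃ (MergedPiece q)
    nonempty (inj₁ i) = x i , x∈MergedPiece i
    nonempty (inj₂ i) = B-nonempty i

    open Labelling G +↔⊎ (merge ∘ piece) MergedPiece
                   (λ _ → (λ e → merge-sound (piece-sound refl) e) , merge-complete) nonempty

    ¬td : ∀ q → ¬ TotalDominating G (MergedPiece q)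
    ¬td (inj₁ zero)    = ¬tdRest∪x₀
    ¬td (inj₁ (suc i)) = ¬TotalDominating-singleton G
    ¬td (inj₂ i)       = B-¬TotalDominating i

    x-pair : ∀ i → TRD G (MergedPiece (inj₁ i) ∪ B i)
    x-pair i = pair-TRD i (x∈MergedPiece i) (MergedPiece-⊆ i)

    coalition : ∀ q → ∃[ q′ ] (q′ ≢ q × TRD G (MergedPiece q ∪ MergedPiece q′))
    coalition (inj₁ i) = inj₂ i , (λ ()) , x-pair i
    coalition (inj₂ i) = inj₁ i , (λ ()) , TRD-∪-comm G (x-pair i)

  trcPartition-≥2d : (∀ k → Σ (Partition G k) (IsTotalDomaticPartition G) → k ≤ d) →
                ∃[ k ] (Σ (Partition G k) (IsTRCPartition G) × 2 * d ≤ k)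
  trcPartition-≥2d maxd with TotalDominating? G (Rest? ∪? (_≟ x zero))
  ... | yes td = d + (d + 1) , restApartPartition td (Rest-¬TotalDominating maxd)
               , +-monoʳ-≤ d (+-monoʳ-≤ d z≤n)
  ... | no ¬td = d + d , restMergedPartition ¬td , +-monoʳ-≤ d (≤-reflexive (+-identityʳ d))

module _ {n : ℕ} (G : Graph n) (noIsolated : NoIsolated G) where

  wholeDomaticPartition : Fin n → Σ (Partition G 1) (IsTotalDomaticPartition G)
  wholeDomaticPartition v =
    record { cls = λ _ → zero ; surj = λ { zero → v , refl } }
    , λ { zero u → let (w , a) = noIsolated u in w , refl , a }

  singletonTRCPartition : Fin n → Σ (Partition G 2) (IsTRCPartition G)
  singletonTRCPartition v₀ = trcPartition ¬trd coalition
    where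
    label : Fin n → Fin 2
    label v with v ≟ v₀
    ... | yes _ = zero
    ... | no  _ = suc zero

    Atom : Fin 2 → VSet n
    Atom zero       = _≡ v₀
    Atom (suc zero) = _≢ v₀

    label-sound : ∀ {p v} → label v ≡ p → Atom p v
    label-sound {v = v} e with v ≟ v₀
    label-sound refl | yes v≡v₀ = v≡v₀
    label-sound refl | no  v≢v₀ = v≢v₀

    label-complete : ∀ {p v} → Atom p v → label v ≡ p
    label-complete {zero} {v} v≡v₀ with v ≟ v₀
    ... | yes _    = refl
    ... | no  v≢v₀ = contradiction v≡v₀ v≢v₀
    label-complete {suc zero} {v} v≢v₀ with v ≟ v₀
    ... | yes v≡v₀ = contradiction v≡v₀ v≢v₀
    ... | no  _    = refl

    nonempty : ∀ p → ∃ (Atom p)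
    nonempty zero       = v₀ , refl
    nonempty (suc zero) = let (u , a) = noIsolated v₀
                          in u , λ u≡v₀ → ¬Adj-refl G (subst (Adj G v₀) u≡v₀ a)

    open Labelling G ↔-refl label Atom (λ _ → label-sound , label-complete) nonempty

    ¬trd : ∀ p → ¬ TRD G (Atom p)
    ¬trd zero       = atom-¬TotalDominating⇒¬TRD zero (¬TotalDominating-singleton G)
    ¬trd (suc zero) = ¬TRD-singleton-complement G

    everything : TRD G (Atom zero ∪ Atom (suc zero))
    everything = (λ v ∉ → contradiction (toSum (v ≟ v₀)) ∉)
               , λ v _ → let (u , a) = noIsolated v in u , toSum (u ≟ v₀) , a

    coalition : ∀ p → ∃[ q ] (q ≢ p × TRD G (Atom p ∪ Atom q))
    coalition zero       = suc zero , (λ ()) , everything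
    coalition (suc zero) = zero , (λ ()) , TRD-∪-comm G everything

corollary2p6 : ∀ {n : ℕ} (G : Graph n) → NoIsolated G →
    ∀ (d : ℕ) → IsTotalDomaticNumber G d →
    ∃[ c ] (IsTRCNumber G c × 2 * d ≤ c)
corollary2p6 {zero} G _ zero _ =
  trcNumber G {0} (record { cls = λ () ; surj = λ () } , (λ ()) , (λ ())) z≤n
corollary2p6 {suc _} G noIsolated zero (_ , maximal) =
  contradiction (maximal 1 (wholeDomaticPartition G noIsolated zero)) λ ()
corollary2p6 G noIsolated 1 ((P , _) , _) =
  trcNumber G (singletonTRCPartition G noIsolated (proj₁ (surj P zero))) ≤-refl
corollary2p6 G _ (suc (suc _)) ((P , tdP) , maximal) =
  let (_ , trc , 2d≤k) = FromTotalDomaticPartition.trcPartition-≥2d G P tdP maximal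
  in trcNumber G trc 2d≤k
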